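{- Let $\varphi,\overline{\varphi}\in\mathcal{L}$ with $\varphi$ consistent. The following are equivalent: (I) $\overline{\varphi}$ is a decreasing relaxation of $\varphi$ such that for all $\pi,\pi'\in\mathcal{G}$, if $\pi\models\overline{\varphi}$ and $\pi'\models\varphi$ then $\pi\circ\pi'\models\varphi$; (II) $\varphi$ is strongly compositional, and for all $\pi\in\mathcal{G}$, $\pi\models^*\varphi$ if and only if $\pi\models\overline{\varphi}$.
   Context: Let $V$ be a finite set of variables with finite nonempty domains. A lex model $\pi$ is a (possibly empty) sequence $(Y_1,\ge_{Y_1}),\ldots,(Y_k,\ge_{Y_k})$ of pairwise distinct variables each with a total order on its domain; $V_\pi=\{Y_1,\ldots,Y_k\}$; $\mathcal{G}$ is the set of lex models. For $\pi'=(Z_1,\ge_{Z_1}),\ldots$, $\pi\circ\pi'$ is $\pi$ followed by $\pi'$ with pairs whose variable is in $V_\pi$ deleted. $\pi'$ extends $\pi$ if $\pi'\ne\pi$ and $\pi'$ begins with $\pi$; $\pi'\sqsupseteq\pi$ means extends or equals. $\mathcal{L}$ is an arbitrary set of statements with satisfaction relation $\models\ \subseteq\mathcal{G}\times\mathcal{L}$; $\varphi$ is consistent if some $\pi$ satisfies it. $\pi\models^*\varphi$ iff some $\pi'\sqsupseteq\pi$ has $\pi'\models\varphi$. $\varphi$ is strongly compositional if for all $\pi,\pi'$, $\pi\models^*\varphi$ and $\pi'\models\varphi$ imply $\pi\circ\pi'\models\varphi$. A statement $\psi$ is decreasing if whenever $\pi'$ extends $\pi$ and $\pi'\models\psi$,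 then $\pi\models\psi$. $\overline{\varphi}$ is a relaxation of $\varphi$ if every $\pi$ with $\pi\models\varphi$ has $\pi\models\overline{\varphi}$. -}

module Defs where

open import Data.Nat using (ℕ)
open import Data.Fin using (Fin; _≟_)
open import Data.Bool using (Bool; true; false; not)
open import Data.List using (List; []; _∷_; _++_; map; filterᵇ)
open import Data.List.Relation.Unary.All using (All)
open import Data.List.Relation.Unary.Unique.Propositional using (Unique)
open import Data.List.Membership.Propositional using (_∈_)
open import Data.Product using (Σ; ∃; _×_; proj₁; proj₂)
open import Relation.Binary.PropositionalEquality using (_≡_; _≢_)
open import Relation.Nullary.Decidable using (⌊_⌋)

-- A (raw) lex model is a list of pairs (variable, ranking of its domain),
-- where a ranking is a list listing the domain from best to worst.
Pair : (n : ℕ) → (Fin n → ℕ) → Set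
Pair n dom = Σ (Fin n) (λ v → List (Fin (dom v)))

Model : (n : ℕ) → (Fin n → ℕ) → Set
Model n dom = List (Pair n dom)

IsTotalOrder : {k : ℕ} → List (Fin k) → Set
IsTotalOrder {k} l = Unique l × (∀ (x : Fin k) → x ∈ l)

-- Membership in 𝒢: pairwise distinct variables, each with a total order.
Valid : {n : ℕ} {dom : Fin n → ℕ} → Model n dom → Set
Valid π = Unique (map proj₁ π) × All (λ p → IsTotalOrder (proj₂ p)) π

vars : {n : ℕ} {dom : Fin n → ℕ} → Model n dom → List (Fin n)
vars π = map proj₁ π

memᵇ : {n : ℕ} → Fin n → List (Fin n) → Bool
memᵇ x [] = false
memᵇ x (y ∷ ys) with ⌊ x ≟ y ⌋
... | true = true
... | false = memᵇ x ys

_∘ₗ_ : {n : ℕ} {dom : Fin n → ℕ} → Model n dom → Model n dom → Model n dom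
π ∘ₗ π' = π ++ filterᵇ (λ p → not (memᵇ (proj₁ p) (vars π))) π'

_⊒_ : {n : ℕ} {dom : Fin n → ℕ} → Model n dom → Model n dom → Set
π' ⊒ π = ∃ λ rest → π' ≡ π ++ rest

Extends : {n : ℕ} {dom : Fin n → ℕ} → Model n dom → Model n dom → Set
Extends π' π = (π' ≢ π) × (π' ⊒ π)

module _ {n : ℕ} {dom : Fin n → ℕ} {L : Set} (_⊨_ : Model n dom → L → Set) where

  Sat* : Model n dom → L → Set
  Sat* π φ = ∃ λ π' → Valid π' × (π' ⊒ π) × (π' ⊨ φ)

  Consistent : L → Set
  Consistent φ = ∃ λ π → Valid π × (π ⊨ φ)

  StronglyCompositional : L → Set
  StronglyCompositional φ = ∀ π π' → Valid π → Valid π' →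
    Sat* π φ → π' ⊨ φ → (π ∘ₗ π') ⊨ φ

  Decreasing : L → Set
  Decreasing ψ = ∀ π π' → Valid π → Valid π' →
    Extends π' π → π' ⊨ ψ → π ⊨ ψ

  Relaxation : L → L → Set
  Relaxation φ̄ φ = ∀ π → Valid π → π ⊨ φ → π ⊨ φ̄

{-# OPTIONS --safe #-}
module Submission where

-- Both conditions say that, on valid models, φ̄ holds exactly where φ holds
-- in some extension.  A decreasing relaxation of φ holds at every such π, and
-- a φ̄ that composes with φ holds only at such π, because π ∘ π₀ begins with π
-- for a model π₀ of φ.  Conversely π ⊨* φ is a relaxation of φ closed under
-- prefixes, and composition hypotheses transfer along the equivalence.

open import Defs
open import Data.Nat using (ℕ; _<_)
open import Data.Fin using (Fin; _≟_)
open import Data.Bool using (Bool; true; false; not; T)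
open import Data.Empty using (⊥)
open import Data.Product using (_×_; _,_; proj₁; proj₂)
open import Data.Sum using (_⊎_; inj₁; inj₂)
open import Data.List using ([]; _∷_; _++_; filterᵇ)
open import Data.List.Properties using (map-++; ++-identityʳ; ++-assoc; ++-identityʳ-unique)
open import Data.List.Membership.Propositional using (_∈_)
open import Data.List.Membership.Propositional.Properties using (∈-map⁻; ∈-filter⁻)
open import Data.List.Relation.Unary.Any using (here; there)
open import Data.List.Relation.Binary.Disjoint.Propositional using (Disjoint)
open import Data.List.Relation.Unary.Unique.Propositional using (Unique)
import Data.List.Relation.Unary.All.Properties as All
import Data.List.Relation.Unary.AllPairs.Properties as AllPairs
import Data.List.Relation.Unary.Unique.Propositional.Properties as Unique
open import Function using (_∘_)
open import Relation.Binary.PropositionalEquality using (_≡_; _≢_; refl; sym; subst)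
open import Relation.Nullary using (yes; no; contradiction)
open import Relation.Nullary.Decidable using (T?)

memᵇ-complete : ∀ {n} {x : Fin n} {ys} → x ∈ ys → T (memᵇ x ys)
memᵇ-complete {x = x} {y ∷ ys} x∈y∷ys with x ≟ y
... | yes _ = _
memᵇ-complete (here x≡y)   | no x≢y = contradiction x≡y x≢y
memᵇ-complete (there x∈ys) | no _   = memᵇ-complete x∈ys

T-not⇒¬T : ∀ {b} → T (not b) → T b → ⊥
T-not⇒¬T {true}  ()
T-not⇒¬T {false} _ ()

module _ {n : ℕ} {dom : Fin n → ℕ} where

  private
    variable
      π π' π'' : Model n dom

  fresh : Model n dom → Pair n dom → Bool
  fresh π p = not (memᵇ (proj₁ p) (vars π))

  vars-disjoint-fresh : ∀ π π' → Disjoint (vars π) (vars (filterᵇ (fresh π) π'))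
  vars-disjoint-fresh π π' (x∈π , x∈rest) with ∈-map⁻ proj₁ x∈rest
  ... | p , p∈rest , refl =
    T-not⇒¬T (proj₂ (∈-filter⁻ (T? ∘ fresh π) {xs = π'} p∈rest)) (memᵇ-complete x∈π)

  ∘ₗ-valid : Valid π → Valid π' → Valid (π ∘ₗ π')
  ∘ₗ-valid {π} {π'} (uπ , oπ) (uπ' , oπ') =
    subst Unique (sym (map-++ proj₁ π rest))
      (Unique.++⁺ uπ uRest (vars-disjoint-fresh π π'))
    , All.++⁺ oπ (All.filter⁺ (T? ∘ fresh π) oπ')
    where
    rest : Model n dom
    rest = filterᵇ (fresh π) π'
    uRest : Unique (vars rest)
    uRest = AllPairs.map⁺ (AllPairs.filter⁺ (T? ∘ fresh π) (AllPairs.map⁻ uπ'))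

  ∘ₗ-⊒ : ∀ π π' → (π ∘ₗ π') ⊒ π
  ∘ₗ-⊒ π π' = filterᵇ (fresh π) π' , refl

  ⊒-refl : π ⊒ π
  ⊒-refl {π} = [] , sym (++-identityʳ π)

  ⊒-trans : π'' ⊒ π' → π' ⊒ π → π'' ⊒ π
  ⊒-trans {π = π} (r' , refl) (r , refl) = r ++ r' , ++-assoc π r r'

  ⊒⇒≡⊎Extends : π' ⊒ π → π' ≡ π ⊎ Extends π' π
  ⊒⇒≡⊎Extends {π = π} ([] , refl) = inj₁ (++-identityʳ π)
  ⊒⇒≡⊎Extends {π = π} (p ∷ r , refl) =
    inj₂ (p∷r≢[] ∘ ++-identityʳ-unique π ∘ sym , (p ∷ r , refl))
    where
    p∷r≢[] : p ∷ r ≢ []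
    p∷r≢[] ()

  module _ {L : Set} (_⊨_ : Model n dom → L → Set) where

    -- StronglyCompositional _⊨_ φ is definitionally Composes (λ π → Sat* _⊨_ π φ) φ.
    Composes : (Model n dom → Set) → L → Set
    Composes P φ = ∀ π π' → Valid π → Valid π' → P π → π' ⊨ φ → (π ∘ₗ π') ⊨ φ

    Composes-antitone : ∀ {P Q φ} → (∀ π → Valid π → P π → Q π) → Composes Q φ → Composes P φ
    Composes-antitone P⇒Q compQ π π' vπ vπ' Pπ = compQ π π' vπ vπ' (P⇒Q π vπ Pπ)

    ⊨⇒Sat* : ∀ {φ} → Valid π → π ⊨ φ → Sat* _⊨_ π φ
    ⊨⇒Sat* {π} vπ π⊨φ = π , vπ , ⊒-refl , π⊨φ

    Sat*-⊒-closed : ∀ {φ} → π' ⊒ π → Sat* _⊨_ π' φ → Sat* _⊨_ π φ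
    Sat*-⊒-closed π'⊒π (ρ , vρ , ρ⊒π' , ρ⊨φ) = ρ , vρ , ⊒-trans ρ⊒π' π'⊒π , ρ⊨φ

    Decreasing⇒⊒-closed : ∀ {ψ} → Decreasing _⊨_ ψ →
      Valid π → Valid π' → π' ⊒ π → π' ⊨ ψ → π ⊨ ψ
    Decreasing⇒⊒-closed {π} {π'} decr vπ vπ' π'⊒π π'⊨ψ with ⊒⇒≡⊎Extends π'⊒π
    ... | inj₁ refl       = π'⊨ψ
    ... | inj₂ π'-extends = decr π π' vπ vπ' π'-extends π'⊨ψ

    Sat*⇒decreasingRelaxation : ∀ {φ φ̄} → Relaxation _⊨_ φ̄ φ → Decreasing _⊨_ φ̄ →
      Valid π → Sat* _⊨_ π φ → π ⊨ φ̄
    Sat*⇒decreasingRelaxation relax decr vπ (ρ , vρ , ρ⊒π , ρ⊨φ) =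
      Decreasing⇒⊒-closed decr vπ vρ ρ⊒π (relax ρ vρ ρ⊨φ)

    Composes⇒Sat* : ∀ {φ φ̄} → Consistent _⊨_ φ → Composes (_⊨ φ̄) φ →
      Valid π → π ⊨ φ̄ → Sat* _⊨_ π φ
    Composes⇒Sat* {π} (π₀ , vπ₀ , π₀⊨φ) comp vπ π⊨φ̄ =
      π ∘ₗ π₀ , ∘ₗ-valid vπ vπ₀ , ∘ₗ-⊒ π π₀ , comp π π₀ vπ vπ₀ π⊨φ̄ π₀⊨φ

proposition5 : (n : ℕ) (dom : Fin n → ℕ) → (∀ v → 0 < dom v) →
    (L : Set) (_⊨_ : Model n dom → L → Set) (φ φ̄ : L) →
    Consistent _⊨_ φ →
    ((Relaxation _⊨_ φ̄ φ × Decreasing _⊨_ φ̄ ×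
        (∀ π π' → Valid π → Valid π' → π ⊨ φ̄ → π' ⊨ φ → (π ∘ₗ π') ⊨ φ))
      → (StronglyCompositional _⊨_ φ ×
        (∀ π → Valid π → (Sat* _⊨_ π φ → π ⊨ φ̄) × (π ⊨ φ̄ → Sat* _⊨_ π φ))))
    × ((StronglyCompositional _⊨_ φ ×
        (∀ π → Valid π → (Sat* _⊨_ π φ → π ⊨ φ̄) × (π ⊨ φ̄ → Sat* _⊨_ π φ)))
      → (Relaxation _⊨_ φ̄ φ × Decreasing _⊨_ φ̄ ×
        (∀ π π' → Valid π → Valid π' → π ⊨ φ̄ → π' ⊨ φ → (π ∘ₗ π') ⊨ φ)))
proposition5 _ _ _ _ _⊨_ φ φ̄ consistent = I⇒II , II⇒I
  where
  Sat*⇔φ̄ : Set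
  Sat*⇔φ̄ = ∀ π → Valid π → (Sat* _⊨_ π φ → π ⊨ φ̄) × (π ⊨ φ̄ → Sat* _⊨_ π φ)

  I⇒II : Relaxation _⊨_ φ̄ φ × Decreasing _⊨_ φ̄ × Composes _⊨_ (_⊨ φ̄) φ →
    StronglyCompositional _⊨_ φ × Sat*⇔φ̄
  I⇒II (relax , decr , comp) =
    Composes-antitone _⊨_ Sat*⇒φ̄ comp ,
    λ π vπ → Sat*⇒φ̄ π vπ , Composes⇒Sat* _⊨_ consistent comp vπ
    where
    Sat*⇒φ̄ : ∀ π → Valid π → Sat* _⊨_ π φ → π ⊨ φ̄
    Sat*⇒φ̄ π = Sat*⇒decreasingRelaxation _⊨_ relax decr

  II⇒I : StronglyCompositional _⊨_ φ × Sat*⇔φ̄ →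
    Relaxation _⊨_ φ̄ φ × Decreasing _⊨_ φ̄ × Composes _⊨_ (_⊨ φ̄) φ
  II⇒I (sc , sat*⇔φ̄) = relax , decr , Composes-antitone _⊨_ (λ π → proj₂ ∘ sat*⇔φ̄ π) sc
    where
    relax : Relaxation _⊨_ φ̄ φ
    relax π vπ = proj₁ (sat*⇔φ̄ π vπ) ∘ ⊨⇒Sat* _⊨_ vπ
    decr : Decreasing _⊨_ φ̄
    decr π π' vπ vπ' (_ , π'⊒π) =
      proj₁ (sat*⇔φ̄ π vπ) ∘ Sat*-⊒-closed _⊨_ π'⊒π ∘ proj₂ (sat*⇔φ̄ π' vπ')
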